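{- Let $n\ge1$, let $H_1,H_2$ be two edge-disjoint Hamilton cycles of $G_{n,2}$ (forming an H.D. of $G_{n,2}$), and let $E_1,E_2$ be two edge-disjoint directed Hamilton cycles of $Q_{2n}$. Then the four Hamilton cycles $f(E_1,H_1)$, $f(E_1,H_2)$, $f(E_2,H_1)$, $f(E_2,H_2)$ of $Q_{4n}$ are pairwise edge-disjoint.
   Context: $G_{n,2}=C_{4^n}\Box C_{4^n}$: vertices $(x,y)$ with $x,y\in\mathbb{Z}/4^n\mathbb{Z}$, adjacent iff they differ in one coordinate by $\pm1$. $Q_{2m}$ is identified with $C_4\Box\cdots\Box C_4$ ($m$ factors): quaternary strings of length $m$, adjacent iff differing in one position by $\pm1\pmod4$. Directed Hamilton cycles start and end at the origin. Definition of $f$: for a directed Hamilton cycle $E$ of $Q_{2n}$, let $\varphi_E(u)=t$ if $u$ is the $t$-th vertex of $E$ (origin is the $0$-th), a bijection $V(Q_{2n})\to\mathbb{Z}/4^n\mathbb{Z}$. Identify $Q_{4n}=Q_{2n}\Box Q_{2n}$, a vertex $(u,v)$ having $u$ on axes $1,\dots,n$ and $v$ on axes $n+1,\dots,2n$. The map $(u,v)\mapsto(\varphi_E(u),\varphi_E(v))$ is a bijection onto $V(G_{n,2})$ fixing the origin, under which every edge of $G_{n,2}$ pulls back to an edge of $Q_{4n}$; for a directed Hamilton cycle $H$ of $G_{n,2}$, $f(E,H)$ is the Hamilton cycle of $Q_{4n}$ that is the preimage of $H$ (with the induced direction). -}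

module Defs where

open import Data.Nat using (ℕ; zero; suc; _+_; _*_; _^_)
open import Data.Fin using (Fin; toℕ)
import Data.Fin as F
open import Data.Vec using (Vec; _∷_; []; replicate; _++_)
open import Data.Product using (_×_; proj₁; proj₂)
open import Data.Sum using (_⊎_)
open import Relation.Binary.PropositionalEquality using (_≡_)
open import Relation.Nullary using (¬_)
open import Function.Definitions using (Bijective)

-- Z/NZ is modelled by Fin N (residues 0..N-1).
-- Step N i j : j = i + 1 (mod N).
Step : (N : ℕ) → Fin N → Fin N → Set
Step N i j = (suc (toℕ i) ≡ toℕ j) ⊎ (suc (toℕ i) ≡ N × toℕ j ≡ 0)

CAdj : (N : ℕ) → Fin N → Fin N → Set
CAdj N i j = Step N i j ⊎ Step N j i

-- Q_{2m} = C_4 □ ... □ C_4 (m factors): quaternary strings of length m,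
-- adjacent iff they differ in exactly one position, by ±1 mod 4.
data QAdj : {m : ℕ} → Vec (Fin 4) m → Vec (Fin 4) m → Set where
  here  : ∀ {m} {a b : Fin 4} {u : Vec (Fin 4) m} → CAdj 4 a b → QAdj (a ∷ u) (b ∷ u)
  there : ∀ {m} {a : Fin 4} {u v : Vec (Fin 4) m} → QAdj u v → QAdj (a ∷ u) (a ∷ v)

QOrigin : (m : ℕ) → Vec (Fin 4) m → Set
QOrigin m u = u ≡ replicate m F.zero

GVert : ℕ → Set
GVert n = Fin (4 ^ n) × Fin (4 ^ n)

GAdj : (n : ℕ) → GVert n → GVert n → Set
GAdj n p q = (CAdj (4 ^ n) (proj₁ p) (proj₁ q) × proj₂ p ≡ proj₂ q)
           ⊎ (proj₁ p ≡ proj₁ q × CAdj (4 ^ n) (proj₂ p) (proj₂ q))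

GOrigin : (n : ℕ) → GVert n → Set
GOrigin n p = toℕ (proj₁ p) ≡ 0 × toℕ (proj₂ p) ≡ 0

-- A directed Hamilton cycle of a graph on N vertices (vertex type V,
-- adjacency Adj, origin predicate IsO), as the sequence t ↦ t-th vertex:
-- a bijection Fin N → V, the 0-th vertex is the origin, and consecutive
-- vertices (including the (N-1)-th and the 0-th) are adjacent.
IsDirHamCycle : {V : Set} (N : ℕ) (Adj : V → V → Set) (IsO : V → Set)
                (c : Fin N → V) → Set
IsDirHamCycle N Adj IsO c =
  Bijective _≡_ _≡_ c
  × (∀ i → toℕ i ≡ 0 → IsO (c i))
  × (∀ i j → Step N i j → Adj (c i) (c j))

IsDirHamQ : (m : ℕ) → (Fin (4 ^ m) → Vec (Fin 4) m) → Set
IsDirHamQ m = IsDirHamCycle (4 ^ m) QAdj (QOrigin m)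

IsDirHamG : (n : ℕ) → (Fin (4 ^ n * 4 ^ n) → GVert n) → Set
IsDirHamG n = IsDirHamCycle (4 ^ n * 4 ^ n) (GAdj n) (GOrigin n)

EdgeDisjoint : {V : Set} (N : ℕ) → (Fin N → V) → (Fin N → V) → Set
EdgeDisjoint N c d =
  ∀ i i' j j' → Step N i i' → Step N j j' →
    ¬ ((c i ≡ d j × c i' ≡ d j') ⊎ (c i ≡ d j' × c i' ≡ d j))

-- f(E,H): vertex (u,v) of Q_{4n} = Q_{2n} □ Q_{2n} is the string u ++ v.
-- Since φ_E is the inverse of E, the preimage of the G-vertex (x,y)
-- is (E x, E y); so the t-th vertex of f(E,H) is E(x_t) ++ E(y_t)
-- where H t = (x_t , y_t).
f : (n : ℕ) → (Fin (4 ^ n) → Vec (Fin 4) n) → (Fin (4 ^ n * 4 ^ n) → GVert n)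
    → Fin (4 ^ n * 4 ^ n) → Vec (Fin 4) (n + n)
f n E H t = E (proj₁ (H t)) ++ E (proj₂ (H t))

-- With concat² E (x , y) = E x ++ E y we have f(E , H) = concat² E ∘ H.  Since E is
-- injective, so is concat² E, hence edge-disjoint H₁ , H₂ stay edge-disjoint.  An edge
-- of concat² E ∘ H changes exactly one half of the string, along an edge {E x , E x'}
-- of E.  If it equalled an edge of concat² E' ∘ H' changing the same half, E and E'
-- would share an edge; if the other half, then E x = E x', i.e. x = x', yet x and x'
-- are adjacent in C_{4^n}, which has no loops.
module Submission where

open import Defs
open import Data.Nat using (ℕ; _≤_; _^_; _*_; _+_; s≤s; z≤n)
open import Data.Nat.Properties using (1+n≢n; <⇒≢; ^-monoʳ-<)
open import Data.Fin using (Fin)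
open import Data.Vec using (Vec; _++_)
open import Data.Vec.Properties using (++-injectiveˡ; ++-injectiveʳ)
open import Data.Product using (_×_; _,_; proj₁; proj₂)
open import Data.Sum using (_⊎_; inj₁; inj₂)
open import Function using (_∘_)
open import Function.Definitions using (Injective)
open import Relation.Nullary using (¬_)
open import Relation.Binary.Definitions using (Symmetric)
open import Relation.Binary.PropositionalEquality

CAdj-sym : ∀ {N} → Symmetric (CAdj N)
CAdj-sym (inj₁ s) = inj₂ s
CAdj-sym (inj₂ s) = inj₁ s

CAdj-irrefl : ∀ {N} → N ≢ 1 → ∀ i → ¬ CAdj N i i
CAdj-irrefl N≢1 i (inj₁ (inj₁ e))       = 1+n≢n e
CAdj-irrefl N≢1 i (inj₁ (inj₂ (e , z))) = N≢1 (trans (sym e) (cong ℕ.suc z))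
CAdj-irrefl N≢1 i (inj₂ (inj₁ e))       = 1+n≢n e
CAdj-irrefl N≢1 i (inj₂ (inj₂ (e , z))) = N≢1 (trans (sym e) (cong ℕ.suc z))

4^n≢1 : ∀ n → 1 ≤ n → 4 ^ n ≢ 1
4^n≢1 n 1≤n = ≢-sym (<⇒≢ (^-monoʳ-< 4 (s≤s (s≤s z≤n)) 1≤n))

CAdj² : (N : ℕ) → Fin N × Fin N → Fin N × Fin N → Set
CAdj² N p q = (CAdj N (proj₁ p) (proj₁ q) × proj₂ p ≡ proj₂ q)
            ⊎ (proj₁ p ≡ proj₁ q × CAdj N (proj₂ p) (proj₂ q))

CAdj²-sym : ∀ {N} → Symmetric (CAdj² N)
CAdj²-sym (inj₁ (c , e)) = inj₁ (CAdj-sym c , sym e)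
CAdj²-sym (inj₂ (e , c)) = inj₂ (sym e , CAdj-sym c)

EdgeDisjoint-CAdj : ∀ {V : Set} {N} {c d : Fin N → V} → EdgeDisjoint N c d →
  ∀ {i i' j j'} → CAdj N i i' → CAdj N j j' → ¬ (c i ≡ d j × c i' ≡ d j')
EdgeDisjoint-CAdj D (inj₁ s) (inj₁ t) (e , e') = D _ _ _ _ s t (inj₁ (e , e'))
EdgeDisjoint-CAdj D (inj₁ s) (inj₂ t) (e , e') = D _ _ _ _ s t (inj₂ (e , e'))
EdgeDisjoint-CAdj D (inj₂ s) (inj₁ t) (e , e') = D _ _ _ _ s t (inj₂ (e' , e))
EdgeDisjoint-CAdj D (inj₂ s) (inj₂ t) (e , e') = D _ _ _ _ s t (inj₁ (e' , e))

EdgeDisjoint-map : ∀ {V W : Set} {N} {c d : Fin N → V} (g : V → W) →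
  Injective _≡_ _≡_ g → EdgeDisjoint N c d → EdgeDisjoint N (g ∘ c) (g ∘ d)
EdgeDisjoint-map g inj D i i' j j' s t (inj₁ (e , e')) = D i i' j j' s t (inj₁ (inj e , inj e'))
EdgeDisjoint-map g inj D i i' j j' s t (inj₂ (e , e')) = D i i' j j' s t (inj₂ (inj e , inj e'))

EdgeDisjoint-walks : ∀ {V W : Set} {N} {Adj : V → V → Set} {c d : Fin N → V}
  (g g' : V → W) → Symmetric Adj →
  (∀ i j → Step N i j → Adj (c i) (c j)) → (∀ i j → Step N i j → Adj (d i) (d j)) →
  (∀ {p p' q q'} → Adj p p' → Adj q q' → ¬ (g p ≡ g' q × g p' ≡ g' q')) →
  EdgeDisjoint N (g ∘ c) (g' ∘ d)
EdgeDisjoint-walks g g' Adj-sym walk-c walk-d disj i i' j j' s t (inj₁ same) =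
  disj (walk-c i i' s) (walk-d j j' t) same
EdgeDisjoint-walks g g' Adj-sym walk-c walk-d disj i i' j j' s t (inj₂ same) =
  disj (walk-c i i' s) (Adj-sym (walk-d j j' t)) same

module _ {A : Set} {m N : ℕ} where

  concat² : (Fin N → Vec A m) → Fin N × Fin N → Vec A (m + m)
  concat² E (x , y) = E x ++ E y

  concat²-injective : {E : Fin N → Vec A m} →
    Injective _≡_ _≡_ E → Injective _≡_ _≡_ (concat² E)
  concat²-injective {E} inj {x , y} {a , b} e =
    cong₂ _,_ (inj (++-injectiveˡ (E x) (E a) e)) (inj (++-injectiveʳ (E x) (E a) e))

  concat²-edges-disjoint : {E E' : Fin N → Vec A m} → N ≢ 1 →
    Injective _≡_ _≡_ E → EdgeDisjoint N E E' →
    ∀ {p p' q q'} → CAdj² N p p' → CAdj² N q q' →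
    ¬ (concat² E p ≡ concat² E' q × concat² E p' ≡ concat² E' q')
  concat²-edges-disjoint {E} {E'} N≢1 inj D {x , y} {x' , y'} {a , b} {a' , b'} g h (e , e')
    with ++-injectiveˡ (E x) (E' a) e | ++-injectiveʳ (E x) (E' a) e
       | ++-injectiveˡ (E x') (E' a') e' | ++-injectiveʳ (E x') (E' a') e'
  ... | ex | ey | ex' | ey' with g | h
  ... | inj₁ (c , _) | inj₁ (d , _) = EdgeDisjoint-CAdj D c d (ex , ex')
  ... | inj₂ (_ , c) | inj₂ (_ , d) = EdgeDisjoint-CAdj D c d (ey , ey')
  ... | inj₁ (c , _) | inj₂ (a≡a' , _) =
    CAdj-irrefl N≢1 x (subst (CAdj N x) (inj (trans ex' (trans (cong E' (sym a≡a')) (sym ex)))) c)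
  ... | inj₂ (_ , c) | inj₁ (_ , b≡b') =
    CAdj-irrefl N≢1 y (subst (CAdj N y) (inj (trans ey' (trans (cong E' (sym b≡b')) (sym ey)))) c)

f-same-cycle : ∀ n {H H' : Fin (4 ^ n * 4 ^ n) → GVert n} {E : Fin (4 ^ n) → Vec (Fin 4) n} →
  IsDirHamQ n E → EdgeDisjoint (4 ^ n * 4 ^ n) H H' →
  EdgeDisjoint (4 ^ n * 4 ^ n) (f n E H) (f n E H')
f-same-cycle n {E = E} hE = EdgeDisjoint-map (concat² E) (concat²-injective (proj₁ (proj₁ hE)))

f-disjoint-cycles : ∀ n → 1 ≤ n → {H H' : Fin (4 ^ n * 4 ^ n) → GVert n}
  {E E' : Fin (4 ^ n) → Vec (Fin 4) n} → IsDirHamG n H → IsDirHamG n H' →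
  IsDirHamQ n E → EdgeDisjoint (4 ^ n) E E' →
  EdgeDisjoint (4 ^ n * 4 ^ n) (f n E H) (f n E' H')
f-disjoint-cycles n 1≤n {E = E} {E'} hH hH' hE D =
  EdgeDisjoint-walks (concat² E) (concat² E') CAdj²-sym (proj₂ (proj₂ hH)) (proj₂ (proj₂ hH'))
    (concat²-edges-disjoint (4^n≢1 n 1≤n) (proj₁ (proj₁ hE)) D)

lemma1 : (n : ℕ) → 1 ≤ n →
    (H₁ H₂ : Fin (4 ^ n * 4 ^ n) → GVert n) →
    IsDirHamG n H₁ → IsDirHamG n H₂ → EdgeDisjoint (4 ^ n * 4 ^ n) H₁ H₂ →
    (E₁ E₂ : Fin (4 ^ n) → Vec (Fin 4) n) →
    IsDirHamQ n E₁ → IsDirHamQ n E₂ → EdgeDisjoint (4 ^ n) E₁ E₂ →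
    EdgeDisjoint (4 ^ n * 4 ^ n) (f n E₁ H₁) (f n E₁ H₂)
    × EdgeDisjoint (4 ^ n * 4 ^ n) (f n E₁ H₁) (f n E₂ H₁)
    × EdgeDisjoint (4 ^ n * 4 ^ n) (f n E₁ H₁) (f n E₂ H₂)
    × EdgeDisjoint (4 ^ n * 4 ^ n) (f n E₁ H₂) (f n E₂ H₁)
    × EdgeDisjoint (4 ^ n * 4 ^ n) (f n E₁ H₂) (f n E₂ H₂)
    × EdgeDisjoint (4 ^ n * 4 ^ n) (f n E₂ H₁) (f n E₂ H₂)
lemma1 n 1≤n H₁ H₂ hH₁ hH₂ DH E₁ E₂ hE₁ hE₂ DE =
    f-same-cycle n hE₁ DH
  , f-disjoint-cycles n 1≤n hH₁ hH₁ hE₁ DE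
  , f-disjoint-cycles n 1≤n hH₁ hH₂ hE₁ DE
  , f-disjoint-cycles n 1≤n hH₂ hH₁ hE₁ DE
  , f-disjoint-cycles n 1≤n hH₂ hH₂ hE₁ DE
  , f-same-cycle n hE₂ DH
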